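{- Let $G$ be a finite simple connected graph on $n$ vertices and let $\alpha\in[0,1)$ be rational. Then $\mathbf 1^TA_{c_\alpha}(G)\mathbf 1\equiv 0\pmod{2c_\alpha}$, and $\mathbf 1^TA_{c_\alpha}(G)^k\mathbf 1\equiv 0\pmod{2c_\alpha^2}$ for every integer $k\geqslant 2$.
   Context: For a graph $G$, $A(G)$ is its adjacency matrix, $D(G)$ its diagonal degree matrix and $A_\alpha(G)=\alpha D(G)+(1-\alpha)A(G)$. For rational $\alpha\in[0,1)$, $c_\alpha$ is the smallest positive integer such that $c_\alpha\alpha$ and $c_\alpha(1-\alpha)$ are integers, and $A_{c_\alpha}(G)=c_\alpha A_\alpha(G)$ (an integral matrix). $\mathbf 1$ is the all-ones vector. -}

module Defs where

open import Data.Nat as ℕ using (ℕ; zero; suc)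
open import Data.Integer as ℤ using (ℤ)
open import Data.Rational using (ℚ; _/_; 0ℚ; 1ℚ; _+_; _*_; _-_; _≤_; _<_)
open import Data.Fin using (Fin; zero; suc)
open import Data.Bool using (Bool; true; false; if_then_else_)
open import Data.Product using (Σ; _×_; ∃; _,_)
open import Relation.Binary.PropositionalEquality using (_≡_; _≢_)
open import Relation.Nullary using (¬_)
open import Data.Fin using (_≟_)
open import Relation.Nullary.Decidable using (does)

record SimpleGraph (n : ℕ) : Set where
  field
    adj     : Fin n → Fin n → Bool
    adj-sym : ∀ i j → adj i j ≡ adj j i
    loopless : ∀ i → adj i i ≡ false
open SimpleGraph public

data Walk {n : ℕ} (G : SimpleGraph n) : Fin n → Fin n → Set where
  here : ∀ {i} → Walk G i i
  step : ∀ {i j k} → adj G i j ≡ true → Walk G j k → Walk G i k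

Connected : ∀ {n} → SimpleGraph n → Set
Connected {n} G = ∀ (i j : Fin n) → Walk G i j

Σℚ : (n : ℕ) → (Fin n → ℚ) → ℚ
Σℚ zero    f = 0ℚ
Σℚ (suc n) f = f zero + Σℚ n (λ i → f (suc i))

Matrix : ℕ → Set
Matrix n = Fin n → Fin n → ℚ

b2ℚ : Bool → ℚ
b2ℚ b = if b then 1ℚ else 0ℚ

idM : ∀ {n} → Matrix n
idM i j = b2ℚ (does (i ≟ j))

_·M_ : ∀ {n} → Matrix n → Matrix n → Matrix n
_·M_ {n} M N i j = Σℚ n (λ l → M i l * N l j)

_^M_ : ∀ {n} → Matrix n → ℕ → Matrix n
M ^M zero  = idM
M ^M suc k = M ·M (M ^M k)

quadOnes : ∀ {n} → Matrix n → ℚ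
quadOnes {n} M = Σℚ n (λ i → Σℚ n (λ j → M i j))

ℕtoℚ : ℕ → ℚ
ℕtoℚ m = ℤ.+ m / 1

ℤtoℚ : ℤ → ℚ
ℤtoℚ z = z / 1

IsInteger : ℚ → Set
IsInteger x = ∃ λ (z : ℤ) → x ≡ ℤtoℚ z

adjMatrix : ∀ {n} → SimpleGraph n → Matrix n
adjMatrix G i j = b2ℚ (adj G i j)

degree : ∀ {n} → SimpleGraph n → Fin n → ℚ
degree {n} G i = Σℚ n (λ j → b2ℚ (adj G i j))

degMatrix : ∀ {n} → SimpleGraph n → Matrix n
degMatrix G i j = if does (i ≟ j) then degree G i else 0ℚ

Aα : ∀ {n} → ℚ → SimpleGraph n → Matrix n
Aα α G i j = α * degMatrix G i j + (1ℚ - α) * adjMatrix G i j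

Admissible : ℚ → ℕ → Set
Admissible α c = (0 ℕ.< c) × IsInteger (ℕtoℚ c * α) × IsInteger (ℕtoℚ c * (1ℚ - α))

IsCα : ℚ → ℕ → Set
IsCα α c = Admissible α c × (∀ c' → Admissible α c' → c ℕ.≤ c')

Ac : ∀ {n} → ℚ → ℕ → SimpleGraph n → Matrix n
Ac α c G i j = ℕtoℚ c * Aα α G i j

DivisibleBy : ℚ → ℕ → Set
DivisibleBy x m = ∃ λ (z : ℤ) → x ≡ ℕtoℚ m * ℤtoℚ z

{-# OPTIONS --safe #-}
-- With the integers a = cα and b = c(1 − α), A_c = aD + bA is a symmetric integer matrix
-- whose row sums are (a + b)d = cd, where d is the degree vector. Hence 1ᵀA_c1 = c·Σd = 2c|E|
-- and 1ᵀA_c^(k+2)1 = c²·dᵀA_c^k d, so it remains to see that e_k = dᵀA_c^k d is even.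
-- For a symmetric integer matrix M one has xᵀMx ≡ Σ M_ii x_i (mod 2), because off-diagonal
-- terms come in equal pairs and x² ≡ x. Therefore e_0 = |d|² ≡ Σd is even,
-- e_(2s+1) = (A_c^s d)ᵀA_c(A_c^s d) ≡ a·e_s and e_(2s+2) = |A_c^(s+1) d|² ≡ 1ᵀA_c^(s+1) d = c·e_s,
-- and strong induction concludes.
module Submission where

open import Defs
open import Algebra.Bundles using (Monoid; Ring)
import Algebra.Properties.Semiring.Sum as SemiringSum
open import Data.Bool using (true; false; if_then_else_)
open import Data.Fin using (Fin; zero; suc; _≟_)
open import Data.Integer using (ℤ; +_; 0ℤ; 1ℤ; _+_; _*_; _-_; -_)
open import Data.Integer.DivMod using (_/ℕ_; _%ℕ_; n%ℕd<d; a≡a%ℕn+[a/ℕn]*n)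
open import Data.Integer.Divisibility.Signed
  using (_∣_; divides; ∣m∣n⇒∣m+n; ∣m⇒∣-m; ∣n⇒∣m*n; *-monoʳ-∣)
import Data.Integer.Properties as ℤP
open import Data.Integer.Tactic.RingSolver using (solve-∀)
open import Data.Nat as ℕ using (ℕ; zero; suc)
open import Data.Nat.Induction using (<-rec)
import Data.Nat.Properties as ℕP
open import Data.Product using (_,_; _×_)
open import Data.Rational as ℚ using (ℚ; 0ℚ; 1ℚ; _≤_; _<_; toℚᵘ)
import Data.Rational.Properties as ℚP
open import Data.Rational.Solver using (module +-*-Solver)
open +-*-Solver using (solve; _:=_; _:+_; _:*_; _:-_; con)
open import Data.Rational.Unnormalised as ℚᵘ using (mkℚᵘ; *≡*)
import Data.Rational.Unnormalised.Properties as ℚᵘP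
open import Data.Vec.Functional using (Vector; map)
open import Function using (_∘_)
open import Relation.Binary.Bundles using (Setoid)
open import Relation.Binary.Structures using (IsEquivalence)
open import Relation.Binary.PropositionalEquality
  using (_≡_; _≗_; refl; sym; trans; cong; cong₂; subst; subst₂; module ≡-Reasoning)
open import Relation.Nullary.Decidable using (does; yes; no)
open import Relation.Nullary.Negation using (contradiction)

module _ {c ℓ} (M : Monoid c ℓ) where
  open Monoid M using (_≈_; ε; ∙-congˡ; identityˡ; identityʳ) renaming (trans to ≈-trans)
  open import Algebra.Properties.Monoid.Sum M using (sum; sum-replicate-zero)

  sum-indicator : ∀ {n} (i : Fin n) v → sum (λ j → if does (i ≟ j) then v else ε) ≈ v
  sum-indicator {suc n} zero    v = ≈-trans (∙-congˡ (sum-replicate-zero n)) (identityʳ v)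
  sum-indicator {suc n} (suc i) v = ≈-trans (identityˡ _) (sum-indicator i v)

open SemiringSum ℤP.+-*-semiring
  using (sum; sum-cong-≗; sum-replicate-zero; ∑-comm; ∑-distrib-+; *-distribˡ-sum; *-distribʳ-sum)

module ℚΣ = SemiringSum (Ring.semiring ℚP.+-*-ring)

infix 4 _≡₂_

_≡₂_ : ℤ → ℤ → Set
x ≡₂ y = + 2 ∣ x - y

≡₂-isEquivalence : IsEquivalence _≡₂_
≡₂-isEquivalence = record
  { refl  = λ {x} → divides 0ℤ (ℤP.+-inverseʳ x)
  ; sym   = λ {x} {y} x≡₂y → subst (+ 2 ∣_) (neg-minus x y) (∣m⇒∣-m x≡₂y)
  ; trans = λ {x} {y} {z} x≡₂y y≡₂z → subst (+ 2 ∣_) (minus-trans x y z) (∣m∣n⇒∣m+n x≡₂y y≡₂z)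
  }
  where
  neg-minus : ∀ x y → - (x - y) ≡ y - x
  neg-minus = solve-∀
  minus-trans : ∀ x y z → (x - y) + (y - z) ≡ x - z
  minus-trans = solve-∀

≡₂-setoid : Setoid _ _
≡₂-setoid = record { isEquivalence = ≡₂-isEquivalence }

≡₂-even : ∀ {x y} → x ≡₂ y → + 2 ∣ y → + 2 ∣ x
≡₂-even {x} {y} x≡₂y 2∣y = subst (+ 2 ∣_) (minus-plus x y) (∣m∣n⇒∣m+n x≡₂y 2∣y)
  where
  minus-plus : ∀ x y → (x - y) + y ≡ x
  minus-plus = solve-∀

*-congˡ-≡₂ : ∀ k {x y} → x ≡₂ y → k * x ≡₂ k * y
*-congˡ-≡₂ k {x} {y} x≡₂y = subst (+ 2 ∣_) (*-distribˡ-minus k x y) (∣n⇒∣m*n k x≡₂y)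
  where
  *-distribˡ-minus : ∀ k x y → k * (x - y) ≡ k * x - k * y
  *-distribˡ-minus = solve-∀

sum-cong-≡₂ : ∀ {n} {f g : Vector ℤ n} → (∀ i → f i ≡₂ g i) → sum f ≡₂ sum g
sum-cong-≡₂ {zero}  _   = divides 0ℤ refl
sum-cong-≡₂ {suc n} {f} {g} f≡₂g =
  subst (+ 2 ∣_) (interchange (f zero) (g zero) (sum (f ∘ suc)) (sum (g ∘ suc)))
    (∣m∣n⇒∣m+n (f≡₂g zero) (sum-cong-≡₂ (f≡₂g ∘ suc)))
  where
  interchange : ∀ a b s t → (a - b) + (s - t) ≡ (a + s) - (b + t)
  interchange = solve-∀

n*n≡₂n : ∀ x → x * x ≡₂ x
n*n≡₂n x with x %ℕ 2 | n%ℕd<d x 2 | a≡a%ℕn+[a/ℕn]*n x 2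
... | 0 | _ | x≡2q = divides (q * (q * + 2 - 1ℤ)) (trans (cong (λ y → y * y - y) x≡2q) (even-case q))
  where
  q = x /ℕ 2
  even-case : ∀ q → (+ 0 + q * + 2) * (+ 0 + q * + 2) - (+ 0 + q * + 2) ≡ (q * (q * + 2 - 1ℤ)) * + 2
  even-case = solve-∀
... | 1 | _ | x≡2q+1 = divides (q * (q * + 2 + 1ℤ)) (trans (cong (λ y → y * y - y) x≡2q+1) (odd-case q))
  where
  q = x /ℕ 2
  odd-case : ∀ q → (+ 1 + q * + 2) * (+ 1 + q * + 2) - (+ 1 + q * + 2) ≡ (q * (q * + 2 + 1ℤ)) * + 2
  odd-case = solve-∀
... | suc (suc _) | ℕ.s≤s (ℕ.s≤s ()) | _

ℤMatrix : ℕ → Set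
ℤMatrix n = Fin n → Fin n → ℤ

module _ {n : ℕ} where

  IsSymmetric : ℤMatrix n → Set
  IsSymmetric M = ∀ i j → M i j ≡ M j i

  diagonal : ℤMatrix n → Vector ℤ n
  diagonal M i = M i i

  rowSums : ℤMatrix n → Vector ℤ n
  rowSums M i = sum (M i)

  ones : Vector ℤ n
  ones _ = 1ℤ

  infixr 7 _*ᵛ_
  _*ᵛ_ : ℤMatrix n → Vector ℤ n → Vector ℤ n
  (M *ᵛ x) i = sum (λ l → M i l * x l)

  _^_*ᵛ_ : ℤMatrix n → ℕ → Vector ℤ n → Vector ℤ n
  M ^ zero  *ᵛ x = x
  M ^ suc k *ᵛ x = M *ᵛ (M ^ k *ᵛ x)

  ⟨_,_⟩ : Vector ℤ n → Vector ℤ n → ℤ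
  ⟨ x , y ⟩ = sum (λ i → x i * y i)

  *ᵛ-congʳ : ∀ M {x y} → x ≗ y → M *ᵛ x ≗ M *ᵛ y
  *ᵛ-congʳ M x≗y i = sum-cong-≗ (λ l → cong (M i l *_) (x≗y l))

  *ᵛ-map-* : ∀ M s x → M *ᵛ map (s *_) x ≗ map (s *_) (M *ᵛ x)
  *ᵛ-map-* M s x i = begin
    sum (λ l → M i l * (s * x l))  ≡⟨ sum-cong-≗ (λ l → swap-* (M i l) s (x l)) ⟩
    sum (λ l → s * (M i l * x l))  ≡⟨ *-distribˡ-sum s (λ l → M i l * x l) ⟨
    s * (M *ᵛ x) i                 ∎
    where
    open ≡-Reasoning
    swap-* : ∀ m s x → m * (s * x) ≡ s * (m * x)
    swap-* = solve-∀

  *ᵛ-ones : ∀ M → M *ᵛ ones ≗ rowSums M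
  *ᵛ-ones M i = sum-cong-≗ (λ l → ℤP.*-identityʳ (M i l))

  ⟨s*x,y⟩≡s*⟨x,y⟩ : ∀ s x y → ⟨ map (s *_) x , y ⟩ ≡ s * ⟨ x , y ⟩
  ⟨s*x,y⟩≡s*⟨x,y⟩ s x y =
    trans (sum-cong-≗ (λ i → ℤP.*-assoc s (x i) (y i))) (sym (*-distribˡ-sum s (λ i → x i * y i)))

  *ᵛ-selfAdjoint : ∀ {M} → IsSymmetric M → ∀ x y → ⟨ M *ᵛ x , y ⟩ ≡ ⟨ x , M *ᵛ y ⟩
  *ᵛ-selfAdjoint {M} M-sym x y = begin
    sum (λ i → sum (λ l → M i l * x l) * y i)    ≡⟨ sum-cong-≗ (λ i → *-distribʳ-sum (y i) (λ l → M i l * x l)) ⟩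
    sum (λ i → sum (λ l → (M i l * x l) * y i))  ≡⟨ ∑-comm (λ i l → (M i l * x l) * y i) ⟩
    sum (λ l → sum (λ i → (M i l * x l) * y i))  ≡⟨ sum-cong-≗ (λ l → sum-cong-≗ (λ i → rearrange l i)) ⟩
    sum (λ l → sum (λ i → x l * (M l i * y i)))  ≡⟨ sum-cong-≗ (λ l → *-distribˡ-sum (x l) (λ i → M l i * y i)) ⟨
    sum (λ l → x l * sum (λ i → M l i * y i))    ∎
    where
    open ≡-Reasoning
    rearrange : ∀ l i → (M i l * x l) * y i ≡ x l * (M l i * y i)
    rearrange l i rewrite M-sym i l = shuffle (M l i) (x l) (y i)
      where
      shuffle : ∀ m x y → (m * x) * y ≡ x * (m * y)
      shuffle = solve-∀

  ^*ᵛ-selfAdjoint : ∀ {M} → IsSymmetric M → ∀ p q x y →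
    ⟨ M ^ p *ᵛ x , M ^ q *ᵛ y ⟩ ≡ ⟨ x , M ^ (p ℕ.+ q) *ᵛ y ⟩
  ^*ᵛ-selfAdjoint M-sym zero    q x y = refl
  ^*ᵛ-selfAdjoint {M} M-sym (suc p) q x y = begin
    ⟨ M *ᵛ (M ^ p *ᵛ x) , M ^ q *ᵛ y ⟩  ≡⟨ *ᵛ-selfAdjoint M-sym _ _ ⟩
    ⟨ M ^ p *ᵛ x , M ^ suc q *ᵛ y ⟩     ≡⟨ ^*ᵛ-selfAdjoint M-sym p (suc q) x y ⟩
    ⟨ x , M ^ (p ℕ.+ suc q) *ᵛ y ⟩      ≡⟨ cong (λ k → ⟨ x , M ^ k *ᵛ y ⟩) (ℕP.+-suc p q) ⟩
    ⟨ x , M ^ suc (p ℕ.+ q) *ᵛ y ⟩      ∎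
    where open ≡-Reasoning

  sum-*ᵛ : ∀ {M} → IsSymmetric M → ∀ x → sum (M *ᵛ x) ≡ ⟨ rowSums M , x ⟩
  sum-*ᵛ {M} M-sym x = begin
    sum (M *ᵛ x)          ≡⟨ sum-cong-≗ (λ i → ℤP.*-identityˡ ((M *ᵛ x) i)) ⟨
    ⟨ ones , M *ᵛ x ⟩     ≡⟨ *ᵛ-selfAdjoint M-sym ones x ⟨
    ⟨ M *ᵛ ones , x ⟩     ≡⟨ sum-cong-≗ (λ i → cong (_* x i) (*ᵛ-ones M i)) ⟩
    ⟨ rowSums M , x ⟩     ∎
    where open ≡-Reasoning

-- The first row and the first column have the same off-diagonal sum R.
sum-rowSums≡₂sum-diagonal : ∀ {n} {M : ℤMatrix n} → IsSymmetric M →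
  sum (rowSums M) ≡₂ sum (diagonal M)
sum-rowSums≡₂sum-diagonal {zero}  _ = divides 0ℤ refl
sum-rowSums≡₂sum-diagonal {suc n} {M} M-sym =
  subst (+ 2 ∣_) (sym split) (∣m∣n⇒∣m+n (divides R (double R)) (sum-rowSums≡₂sum-diagonal M′-sym))
  where
  M′ : ℤMatrix n
  M′ i j = M (suc i) (suc j)
  M′-sym : IsSymmetric M′
  M′-sym i j = M-sym (suc i) (suc j)
  R : ℤ
  R = sum (λ j → M zero (suc j))
  double : ∀ r → r + r ≡ r * + 2
  double = solve-∀
  lower : sum (λ i → M (suc i) zero + rowSums M′ i) ≡ R + sum (rowSums M′)
  lower = trans (∑-distrib-+ (λ i → M (suc i) zero) (rowSums M′))
                (cong (_+ sum (rowSums M′)) (sum-cong-≗ (λ i → M-sym (suc i) zero)))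
  regroup : ∀ m r s t → (m + r) + (r + s) - (m + t) ≡ (r + r) + (s - t)
  regroup = solve-∀
  split : sum (rowSums M) - sum (diagonal M) ≡ (R + R) + (sum (rowSums M′) - sum (diagonal M′))
  split = trans (cong (λ l → (M zero zero + R) + l - sum (diagonal M)) lower)
                (regroup (M zero zero) R (sum (rowSums M′)) (sum (diagonal M′)))

⟨x,x⟩≡₂sum : ∀ {n} (x : Vector ℤ n) → ⟨ x , x ⟩ ≡₂ sum x
⟨x,x⟩≡₂sum x = sum-cong-≡₂ (λ i → n*n≡₂n (x i))

⟨x,M*ᵛx⟩≡₂⟨diagonal,x⟩ : ∀ {n} {M : ℤMatrix n} → IsSymmetric M →
  ∀ x → ⟨ x , M *ᵛ x ⟩ ≡₂ ⟨ diagonal M , x ⟩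
⟨x,M*ᵛx⟩≡₂⟨diagonal,x⟩ {n} {M} M-sym x = begin
  ⟨ x , M *ᵛ x ⟩                   ≡⟨ sum-cong-≗ (λ i → *-distribˡ-sum (x i) (λ l → M i l * x l)) ⟩
  sum (rowSums Q)                  ≈⟨ sum-rowSums≡₂sum-diagonal Q-sym ⟩
  sum (diagonal Q)                 ≡⟨ sum-cong-≗ (λ i → reorder (x i) (M i i)) ⟩
  sum (λ i → M i i * (x i * x i))  ≈⟨ sum-cong-≡₂ (λ i → *-congˡ-≡₂ (M i i) (n*n≡₂n (x i))) ⟩
  ⟨ diagonal M , x ⟩               ∎
  where
  open import Relation.Binary.Reasoning.Setoid ≡₂-setoid
  Q : ℤMatrix n
  Q i l = x i * (M i l * x l)
  swap-ends : ∀ y m z → y * (m * z) ≡ z * (m * y)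
  swap-ends = solve-∀
  Q-sym : IsSymmetric Q
  Q-sym i l rewrite M-sym i l = swap-ends (x i) (M l i) (x l)
  reorder : ∀ y m → y * (m * y) ≡ m * (y * y)
  reorder = solve-∀

data EvenOrOdd : ℕ → Set where
  even : ∀ s → EvenOrOdd (s ℕ.+ s)
  odd  : ∀ s → EvenOrOdd (suc (s ℕ.+ s))

evenOrOdd : ∀ j → EvenOrOdd j
evenOrOdd zero = even 0
evenOrOdd (suc j) with evenOrOdd j
... | even s = odd s
... | odd s  = subst (EvenOrOdd ∘ suc) (ℕP.+-suc s s) (even (suc s))

-- For A = A(G), a = c_α α and b = c_α (1 − α), N is A_{c_α}(G).
module aD+bA {n} (A : ℤMatrix n) (A-sym : IsSymmetric A) (A-diagonal : ∀ i → A i i ≡ 0ℤ) (a b : ℤ) where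

  degrees : Vector ℤ n
  degrees = rowSums A

  D : ℤMatrix n
  D i j = if does (i ≟ j) then degrees i else 0ℤ

  N : ℤMatrix n
  N i j = a * D i j + b * A i j

  D-sym : IsSymmetric D
  D-sym i j with i ≟ j | j ≟ i
  ... | yes refl | yes _   = refl
  ... | yes refl | no  i≢i = contradiction refl i≢i
  ... | no  j≢j  | yes refl = contradiction refl j≢j
  ... | no  _    | no  _   = refl

  N-sym : IsSymmetric N
  N-sym i j = cong₂ (λ d e → a * d + b * e) (D-sym i j) (A-sym i j)

  diagonal-N : ∀ i → diagonal N i ≡ a * degrees i
  diagonal-N i with i ≟ i
  ... | yes _   = trans (cong (λ e → a * degrees i + b * e) (A-diagonal i)) (plus-zero (a * degrees i) b)
    where
    plus-zero : ∀ x b → x + b * 0ℤ ≡ x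
    plus-zero = solve-∀
  ... | no  i≢i = contradiction refl i≢i

  rowSums-N : ∀ i → rowSums N i ≡ (a + b) * degrees i
  rowSums-N i = begin
    sum (λ j → a * D i j + b * A i j)
      ≡⟨ ∑-distrib-+ (λ j → a * D i j) (λ j → b * A i j) ⟩
    sum (λ j → a * D i j) + sum (λ j → b * A i j)
      ≡⟨ cong₂ _+_ (*-distribˡ-sum a (D i)) (*-distribˡ-sum b (A i)) ⟨
    a * sum (D i) + b * degrees i
      ≡⟨ cong (λ s → a * s + b * degrees i) (sum-indicator ℤP.+-0-monoid i (degrees i)) ⟩
    a * degrees i + b * degrees i
      ≡⟨ ℤP.*-distribʳ-+ (degrees i) a b ⟨
    (a + b) * degrees i
      ∎
    where open ≡-Reasoning

  handshake : + 2 ∣ sum degrees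
  handshake = ≡₂-even (sum-rowSums≡₂sum-diagonal A-sym)
    (subst (+ 2 ∣_) (sym trace-zero) (divides 0ℤ refl))
    where
    trace-zero : sum (diagonal A) ≡ 0ℤ
    trace-zero = trans (sum-cong-≗ A-diagonal) (sum-replicate-zero n)

  ⟨rowSums-N,x⟩ : ∀ x → ⟨ rowSums N , x ⟩ ≡ (a + b) * ⟨ degrees , x ⟩
  ⟨rowSums-N,x⟩ x = trans (sum-cong-≗ (λ i → cong (_* x i) (rowSums-N i))) (⟨s*x,y⟩≡s*⟨x,y⟩ (a + b) degrees x)

  ⟨diagonal-N,x⟩ : ∀ x → ⟨ diagonal N , x ⟩ ≡ a * ⟨ degrees , x ⟩
  ⟨diagonal-N,x⟩ x = trans (sum-cong-≗ (λ i → cong (_* x i) (diagonal-N i))) (⟨s*x,y⟩≡s*⟨x,y⟩ a degrees x)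

  sum-N*ᵛ : ∀ x → sum (N *ᵛ x) ≡ (a + b) * ⟨ degrees , x ⟩
  sum-N*ᵛ x = trans (sum-*ᵛ N-sym x) (⟨rowSums-N,x⟩ x)

  2∣⟨degrees,N^j*ᵛdegrees⟩ : ∀ j → + 2 ∣ ⟨ degrees , N ^ j *ᵛ degrees ⟩
  2∣⟨degrees,N^j*ᵛdegrees⟩ = <-rec _ halving-step
    where
    open import Relation.Binary.Reasoning.Setoid ≡₂-setoid
    e : ℕ → ℤ
    e j = ⟨ degrees , N ^ j *ᵛ degrees ⟩
    halving-step : ∀ j → (∀ {i} → i ℕ.< j → + 2 ∣ e i) → + 2 ∣ e j
    halving-step j rec with evenOrOdd j
    ... | even zero    = ≡₂-even (⟨x,x⟩≡₂sum degrees) handshake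
    ... | even (suc s) = ≡₂-even e-even (∣n⇒∣m*n (a + b) (rec (ℕ.s≤s (ℕP.m≤m+n s (suc s)))))
      where
      e-even : e (suc s ℕ.+ suc s) ≡₂ (a + b) * e s
      e-even = begin
        e (suc s ℕ.+ suc s)                            ≡⟨ ^*ᵛ-selfAdjoint N-sym (suc s) (suc s) degrees degrees ⟨
        ⟨ N ^ suc s *ᵛ degrees , N ^ suc s *ᵛ degrees ⟩  ≈⟨ ⟨x,x⟩≡₂sum (N ^ suc s *ᵛ degrees) ⟩
        sum (N *ᵛ (N ^ s *ᵛ degrees))                  ≡⟨ sum-N*ᵛ (N ^ s *ᵛ degrees) ⟩
        (a + b) * e s                                  ∎
    ... | odd s        = ≡₂-even e-odd (∣n⇒∣m*n a (rec (ℕ.s≤s (ℕP.m≤m+n s s))))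
      where
      e-odd : e (suc (s ℕ.+ s)) ≡₂ a * e s
      e-odd = begin
        e (suc (s ℕ.+ s))                              ≡⟨ cong e (ℕP.+-suc s s) ⟨
        e (s ℕ.+ suc s)                                ≡⟨ ^*ᵛ-selfAdjoint N-sym s (suc s) degrees degrees ⟨
        ⟨ N ^ s *ᵛ degrees , N *ᵛ (N ^ s *ᵛ degrees) ⟩  ≈⟨ ⟨x,M*ᵛx⟩≡₂⟨diagonal,x⟩ N-sym (N ^ s *ᵛ degrees) ⟩
        ⟨ diagonal N , N ^ s *ᵛ degrees ⟩              ≡⟨ ⟨diagonal-N,x⟩ (N ^ s *ᵛ degrees) ⟩
        a * e s                                        ∎

  N^[1+k]*ᵛones : ∀ k → N ^ suc k *ᵛ ones ≗ map ((a + b) *_) (N ^ k *ᵛ degrees)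
  N^[1+k]*ᵛones zero    i = trans (*ᵛ-ones N i) (rowSums-N i)
  N^[1+k]*ᵛones (suc k) i = trans (*ᵛ-congʳ N (N^[1+k]*ᵛones k) i) (*ᵛ-map-* N (a + b) (N ^ k *ᵛ degrees) i)

  2[a+b]∣sum-rowSums-N : + 2 * (a + b) ∣ sum (rowSums N)
  2[a+b]∣sum-rowSums-N = subst₂ _∣_ (ℤP.*-comm (a + b) (+ 2)) (sym sum-rowSums-N) (*-monoʳ-∣ (a + b) handshake)
    where
    sum-rowSums-N : sum (rowSums N) ≡ (a + b) * sum degrees
    sum-rowSums-N = trans (sum-cong-≗ rowSums-N) (sym (*-distribˡ-sum (a + b) degrees))

  2[a+b]²∣sum-N^[2+k]*ᵛones : ∀ k → + 2 * ((a + b) * (a + b)) ∣ sum (N ^ suc (suc k) *ᵛ ones)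
  2[a+b]²∣sum-N^[2+k]*ᵛones k = subst₂ _∣_ (ℤP.*-comm ((a + b) * (a + b)) (+ 2)) (sym sum-N^2+k)
    (*-monoʳ-∣ ((a + b) * (a + b)) (2∣⟨degrees,N^j*ᵛdegrees⟩ k))
    where
    open ≡-Reasoning
    sum-N^2+k : sum (N ^ suc (suc k) *ᵛ ones) ≡ ((a + b) * (a + b)) * ⟨ degrees , N ^ k *ᵛ degrees ⟩
    sum-N^2+k = begin
      sum (N ^ suc (suc k) *ᵛ ones)                   ≡⟨ sum-cong-≗ (N^[1+k]*ᵛones (suc k)) ⟩
      sum (map ((a + b) *_) (N *ᵛ (N ^ k *ᵛ degrees)))  ≡⟨ *-distribˡ-sum (a + b) (N *ᵛ (N ^ k *ᵛ degrees)) ⟨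
      (a + b) * sum (N *ᵛ (N ^ k *ᵛ degrees))          ≡⟨ cong ((a + b) *_) (sum-N*ᵛ (N ^ k *ᵛ degrees)) ⟩
      (a + b) * ((a + b) * ⟨ degrees , N ^ k *ᵛ degrees ⟩)  ≡⟨ ℤP.*-assoc (a + b) (a + b) _ ⟨
      ((a + b) * (a + b)) * ⟨ degrees , N ^ k *ᵛ degrees ⟩  ∎

Σℚ≡sum : ∀ n (f : Vector ℚ n) → Σℚ n f ≡ ℚΣ.sum f
Σℚ≡sum zero    f = refl
Σℚ≡sum (suc n) f = cong (f zero ℚ.+_) (Σℚ≡sum n (f ∘ suc))

toℚᵘ-ℤtoℚ : ∀ z → toℚᵘ (ℤtoℚ z) ℚᵘ.≃ mkℚᵘ z 0
toℚᵘ-ℤtoℚ z = ℚP.toℚᵘ-fromℚᵘ (mkℚᵘ z 0)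

ℤtoℚ-+ : ∀ x y → ℤtoℚ (x + y) ≡ ℤtoℚ x ℚ.+ ℤtoℚ y
ℤtoℚ-+ x y = ℚP.toℚᵘ-injective (begin
  toℚᵘ (ℤtoℚ (x + y))               ≈⟨ toℚᵘ-ℤtoℚ (x + y) ⟩
  mkℚᵘ (x + y) 0                    ≈⟨ *≡* (over-one x y) ⟩
  mkℚᵘ x 0 ℚᵘ.+ mkℚᵘ y 0            ≈⟨ ℚᵘP.+-cong (toℚᵘ-ℤtoℚ x) (toℚᵘ-ℤtoℚ y) ⟨
  toℚᵘ (ℤtoℚ x) ℚᵘ.+ toℚᵘ (ℤtoℚ y)  ≈⟨ ℚP.toℚᵘ-homo-+ (ℤtoℚ x) (ℤtoℚ y) ⟨
  toℚᵘ (ℤtoℚ x ℚ.+ ℤtoℚ y)          ∎)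
  where
  open ℚᵘP.≃-Reasoning
  over-one : ∀ x y → (x + y) * + 1 ≡ (x * + 1 + y * + 1) * + 1
  over-one = solve-∀

ℤtoℚ-* : ∀ x y → ℤtoℚ (x * y) ≡ ℤtoℚ x ℚ.* ℤtoℚ y
ℤtoℚ-* x y = ℚP.toℚᵘ-injective (begin
  toℚᵘ (ℤtoℚ (x * y))               ≈⟨ toℚᵘ-ℤtoℚ (x * y) ⟩
  mkℚᵘ (x * y) 0                    ≡⟨⟩
  mkℚᵘ x 0 ℚᵘ.* mkℚᵘ y 0            ≈⟨ ℚᵘP.*-cong (toℚᵘ-ℤtoℚ x) (toℚᵘ-ℤtoℚ y) ⟨
  toℚᵘ (ℤtoℚ x) ℚᵘ.* toℚᵘ (ℤtoℚ y)  ≈⟨ ℚP.toℚᵘ-homo-* (ℤtoℚ x) (ℤtoℚ y) ⟨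
  toℚᵘ (ℤtoℚ x ℚ.* ℤtoℚ y)          ∎)
  where open ℚᵘP.≃-Reasoning

ℤtoℚ-injective : ∀ {x y} → ℤtoℚ x ≡ ℤtoℚ y → x ≡ y
ℤtoℚ-injective {x} {y} eq
  with ℚᵘP.≃-trans (ℚᵘP.≃-sym (toℚᵘ-ℤtoℚ x)) (ℚᵘP.≃-trans (ℚP.toℚᵘ-cong eq) (toℚᵘ-ℤtoℚ y))
... | *≡* x*1≡y*1 = trans (sym (ℤP.*-identityʳ x)) (trans x*1≡y*1 (ℤP.*-identityʳ y))

ℤtoℚ-sum : ∀ {n} (f : Vector ℤ n) → ℤtoℚ (sum f) ≡ ℚΣ.sum (ℤtoℚ ∘ f)
ℤtoℚ-sum {zero}  f = refl
ℤtoℚ-sum {suc n} f =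
  trans (ℤtoℚ-+ (f zero) (sum (f ∘ suc))) (cong (ℤtoℚ (f zero) ℚ.+_) (ℤtoℚ-sum (f ∘ suc)))

quadOnes-rowSums : ∀ {n} (P : Matrix n) (v : Vector ℤ n) →
  (∀ i → ℚΣ.sum (P i) ≡ ℤtoℚ (v i)) → quadOnes P ≡ ℤtoℚ (sum v)
quadOnes-rowSums {n} P v rows = begin
  Σℚ n (λ i → Σℚ n (P i))        ≡⟨ Σℚ≡sum n (λ i → Σℚ n (P i)) ⟩
  ℚΣ.sum (λ i → Σℚ n (P i))      ≡⟨ ℚΣ.sum-cong-≗ (λ i → trans (Σℚ≡sum n (P i)) (rows i)) ⟩
  ℚΣ.sum (ℤtoℚ ∘ v)              ≡⟨ ℤtoℚ-sum v ⟨
  ℤtoℚ (sum v)                   ∎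
  where open ≡-Reasoning

module _ {n} {P : Matrix n} (Q : ℤMatrix n) (P≡Q : ∀ i j → P i j ≡ ℤtoℚ (Q i j)) where

  sum-row : ∀ i → ℚΣ.sum (P i) ≡ ℤtoℚ (rowSums Q i)
  sum-row i = trans (ℚΣ.sum-cong-≗ (P≡Q i)) (sym (ℤtoℚ-sum (Q i)))

  sum-row-^M : ∀ k i → ℚΣ.sum ((P ^M k) i) ≡ ℤtoℚ ((Q ^ k *ᵛ ones) i)
  sum-row-^M zero    i = sum-indicator ℚP.+-0-monoid i 1ℚ
  sum-row-^M (suc k) i = begin
    ℚΣ.sum (λ j → Σℚ n (λ l → P i l ℚ.* (P ^M k) l j))
      ≡⟨ ℚΣ.sum-cong-≗ (λ j → Σℚ≡sum n (λ l → P i l ℚ.* (P ^M k) l j)) ⟩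
    ℚΣ.sum (λ j → ℚΣ.sum (λ l → P i l ℚ.* (P ^M k) l j))
      ≡⟨ ℚΣ.∑-comm (λ j l → P i l ℚ.* (P ^M k) l j) ⟩
    ℚΣ.sum (λ l → ℚΣ.sum (λ j → P i l ℚ.* (P ^M k) l j))
      ≡⟨ ℚΣ.sum-cong-≗ (λ l → ℚΣ.*-distribˡ-sum (P i l) ((P ^M k) l)) ⟨
    ℚΣ.sum (λ l → P i l ℚ.* ℚΣ.sum ((P ^M k) l))
      ≡⟨ ℚΣ.sum-cong-≗ (λ l → cong₂ ℚ._*_ (P≡Q i l) (sum-row-^M k l)) ⟩
    ℚΣ.sum (λ l → ℤtoℚ (Q i l) ℚ.* ℤtoℚ ((Q ^ k *ᵛ ones) l))
      ≡⟨ ℚΣ.sum-cong-≗ (λ l → ℤtoℚ-* (Q i l) ((Q ^ k *ᵛ ones) l)) ⟨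
    ℚΣ.sum (λ l → ℤtoℚ (Q i l * (Q ^ k *ᵛ ones) l))
      ≡⟨ ℤtoℚ-sum (λ l → Q i l * (Q ^ k *ᵛ ones) l) ⟨
    ℤtoℚ ((Q ^ suc k *ᵛ ones) i)
      ∎
    where open ≡-Reasoning

  quadOnes≡sum-rowSums : quadOnes P ≡ ℤtoℚ (sum (rowSums Q))
  quadOnes≡sum-rowSums = quadOnes-rowSums P (rowSums Q) sum-row

  quadOnes-^M : ∀ k → quadOnes (P ^M k) ≡ ℤtoℚ (sum (Q ^ k *ᵛ ones))
  quadOnes-^M k = quadOnes-rowSums (P ^M k) (Q ^ k *ᵛ ones) (sum-row-^M k)

module IntegralModel {n} (G : SimpleGraph n) (a b : ℤ) where

  Aℤ : ℤMatrix n
  Aℤ i j = if adj G i j then 1ℤ else 0ℤ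

  open aD+bA Aℤ (λ i j → cong (if_then 1ℤ else 0ℤ) (adj-sym G i j))
                (λ i → cong (if_then 1ℤ else 0ℤ) (loopless G i)) a b public

  adjMatrix≡Aℤ : ∀ i j → adjMatrix G i j ≡ ℤtoℚ (Aℤ i j)
  adjMatrix≡Aℤ i j with adj G i j
  ... | true  = refl
  ... | false = refl

  degMatrix≡D : ∀ i j → degMatrix G i j ≡ ℤtoℚ (D i j)
  degMatrix≡D i j with does (i ≟ j)
  ... | true  = trans (Σℚ≡sum n (adjMatrix G i)) (sum-row Aℤ adjMatrix≡Aℤ i)
  ... | false = refl

  Ac≡N : ∀ α c → ℕtoℚ c ℚ.* α ≡ ℤtoℚ a → ℕtoℚ c ℚ.* (1ℚ ℚ.- α) ≡ ℤtoℚ b →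
    ∀ i j → Ac α c G i j ≡ ℤtoℚ (N i j)
  Ac≡N α c cα≡a c[1-α]≡b i j = begin
    ℕtoℚ c ℚ.* (α ℚ.* degMatrix G i j ℚ.+ (1ℚ ℚ.- α) ℚ.* adjMatrix G i j)
      ≡⟨ distribute (ℕtoℚ c) α (degMatrix G i j) (adjMatrix G i j) ⟩
    (ℕtoℚ c ℚ.* α) ℚ.* degMatrix G i j ℚ.+ (ℕtoℚ c ℚ.* (1ℚ ℚ.- α)) ℚ.* adjMatrix G i j
      ≡⟨ cong₂ ℚ._+_ (cong₂ ℚ._*_ cα≡a (degMatrix≡D i j)) (cong₂ ℚ._*_ c[1-α]≡b (adjMatrix≡Aℤ i j)) ⟩
    ℤtoℚ a ℚ.* ℤtoℚ (D i j) ℚ.+ ℤtoℚ b ℚ.* ℤtoℚ (Aℤ i j)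
      ≡⟨ cong₂ ℚ._+_ (ℤtoℚ-* a (D i j)) (ℤtoℚ-* b (Aℤ i j)) ⟨
    ℤtoℚ (a * D i j) ℚ.+ ℤtoℚ (b * Aℤ i j)
      ≡⟨ ℤtoℚ-+ (a * D i j) (b * Aℤ i j) ⟨
    ℤtoℚ (N i j)
      ∎
    where
    open ≡-Reasoning
    distribute : ∀ C α D A →
      C ℚ.* (α ℚ.* D ℚ.+ (1ℚ ℚ.- α) ℚ.* A) ≡ (C ℚ.* α) ℚ.* D ℚ.+ (C ℚ.* (1ℚ ℚ.- α)) ℚ.* A
    distribute = solve 4 (λ C α D A →
      C :* (α :* D :+ (con 1ℚ :- α) :* A) := (C :* α) :* D :+ (C :* (con 1ℚ :- α)) :* A) refl

integral-parts-sum : ∀ α c a b → ℕtoℚ c ℚ.* α ≡ ℤtoℚ a → ℕtoℚ c ℚ.* (1ℚ ℚ.- α) ≡ ℤtoℚ b →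
  + c ≡ a + b
integral-parts-sum α c a b cα≡a c[1-α]≡b = ℤtoℚ-injective (begin
  ℕtoℚ c                                  ≡⟨ split-one (ℕtoℚ c) α ⟨
  ℕtoℚ c ℚ.* α ℚ.+ ℕtoℚ c ℚ.* (1ℚ ℚ.- α)  ≡⟨ cong₂ ℚ._+_ cα≡a c[1-α]≡b ⟩
  ℤtoℚ a ℚ.+ ℤtoℚ b                       ≡⟨ ℤtoℚ-+ a b ⟨
  ℤtoℚ (a + b)                            ∎)
  where
  open ≡-Reasoning
  split-one : ∀ C α → C ℚ.* α ℚ.+ C ℚ.* (1ℚ ℚ.- α) ≡ C
  split-one = solve 2 (λ C α → C :* α :+ C :* (con 1ℚ :- α) := C) refl

∣⇒DivisibleBy : ∀ {m x y} → x ≡ ℤtoℚ y → + m ∣ y → DivisibleBy x m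
∣⇒DivisibleBy {m} x≡y (divides q y≡q*m) =
  q , trans x≡y (trans (cong ℤtoℚ (trans y≡q*m (ℤP.*-comm q (+ m)))) (ℤtoℚ-* (+ m) q))

lemma2p6 : ∀ (n : ℕ) (G : SimpleGraph n) → Connected G →
    ∀ (α : ℚ) → 0ℚ ≤ α → α < 1ℚ →
    ∀ (c : ℕ) → IsCα α c →
    DivisibleBy (quadOnes (Ac α c G)) (2 ℕ.* c)
      × (∀ (k : ℕ) → 2 ℕ.≤ k → DivisibleBy (quadOnes (Ac α c G ^M k)) (2 ℕ.* (c ℕ.* c)))
lemma2p6 n G _ α _ _ c ((_ , (a , cα≡a) , (b , c[1-α]≡b)) , _) = first , higher
  where
  open IntegralModel G a b
  Ac≡Nℤ : ∀ i j → Ac α c G i j ≡ ℤtoℚ (N i j)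
  Ac≡Nℤ = Ac≡N α c cα≡a c[1-α]≡b
  c≡a+b : + c ≡ a + b
  c≡a+b = integral-parts-sum α c a b cα≡a c[1-α]≡b
  2c≡2[a+b] : + (2 ℕ.* c) ≡ + 2 * (a + b)
  2c≡2[a+b] = trans (ℤP.pos-* 2 c) (cong (+ 2 *_) c≡a+b)
  2c²≡2[a+b]² : + (2 ℕ.* (c ℕ.* c)) ≡ + 2 * ((a + b) * (a + b))
  2c²≡2[a+b]² = trans (ℤP.pos-* 2 (c ℕ.* c)) (cong (+ 2 *_) (trans (ℤP.pos-* c c) (cong₂ _*_ c≡a+b c≡a+b)))

  first : DivisibleBy (quadOnes (Ac α c G)) (2 ℕ.* c)
  first = ∣⇒DivisibleBy (quadOnes≡sum-rowSums N Ac≡Nℤ)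
    (subst (_∣ sum (rowSums N)) (sym 2c≡2[a+b]) 2[a+b]∣sum-rowSums-N)

  higher : ∀ k → 2 ℕ.≤ k → DivisibleBy (quadOnes (Ac α c G ^M k)) (2 ℕ.* (c ℕ.* c))
  higher (suc (suc k)) (ℕ.s≤s (ℕ.s≤s ℕ.z≤n)) = ∣⇒DivisibleBy (quadOnes-^M N Ac≡Nℤ (suc (suc k)))
    (subst (_∣ sum (N ^ suc (suc k) *ᵛ ones)) (sym 2c²≡2[a+b]²) (2[a+b]²∣sum-N^[2+k]*ᵛones k))
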